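{- Let $k\ge 1$ and let $G_k$ be the graph constructed as follows: take the disjoint union of $k$ copies of $K_{2,2}$, the $i$-th copy ($i\in\{1,\dots,k\}$) having bipartition $\{x_i,x_i'\}$, $\{y_i,y_i'\}$; add a vertex $w$ adjacent to $x_i$ and $x_i'$ for every $i\in\{1,\dots,k\}$; finally add a vertex $w'$ and the edge $ww'$. Then $G_k$ is $(k+1)$-$\gamma_{\rm MB}$-critical, i.e. $\gamma_{\rm MB}(G_k)=k+1$ and $\gamma_{\rm MB}(G_k-e)>k+1$ for every edge $e\in E(G_k)$.
   Context: The Maker-Breaker domination (MBD) game on a graph $G$ is played by Dominator and Staller, who alternately select previously unselected vertices of $G$. Dominator wins if the set of vertices he has selected becomes a dominating set of $G$; Staller wins if she has selected at least one vertex of every dominating set of $G$ (equivalently, all vertices of some closed neighbourhood $N[v]$). In the D-game Dominator moves first. $\gamma_{\rm MB}(G)$ is the minimum number $k$ such that Dominator has a strategy in the D-game guaranteeing that he wins having made at most $k$ moves, whatever Staller does; $\gamma_{\rm MB}(G)=\infty$ if Dominator has no winning strategy. A graph $G$ is $\gamma_{\rm MB}$-critical if $\gamma_{\rm MB}(G)<\gamma_{\rm MB}(G-e)$ for every $e\in E(G)$, and $k$-$\gamma_{\rm MB}$-critical if moreover $\gamma_{\rm MB}(G)=k$. -}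

module Defs where

open import Data.Nat using (ℕ; zero; suc; _<_; _≤_)
open import Data.Fin as Fin using (Fin)
open import Data.Bool using (Bool; true; false; _∧_; _∨_; not)
open import Data.Product using (Σ; ∃; _×_; _,_)
open import Data.Sum using (_⊎_)
open import Relation.Nullary using (¬_; yes; no)
open import Relation.Nullary.Decidable using (⌊_⌋; map′)
open import Relation.Binary.Definitions using (DecidableEquality)
open import Relation.Binary.PropositionalEquality using (_≡_; _≢_; refl; cong)
open import Data.Bool.Properties using (∨-comm)

record Graph (V : Set) : Set where
  field
    adj    : V → V → Bool
    sym    : ∀ u v → adj u v ≡ adj v u
    irrefl : ∀ v → adj v v ≡ false
open Graph public

module _ {V : Set} (_≟_ : DecidableEquality V) where

  sameEdge : V → V → V → V → Bool
  sameEdge a b u v = (⌊ u ≟ a ⌋ ∧ ⌊ v ≟ b ⌋) ∨ (⌊ u ≟ b ⌋ ∧ ⌊ v ≟ a ⌋)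

  removeEdge : Graph V → V → V → Graph V
  removeEdge G a b = record
    { adj = λ u v → adj G u v ∧ not (sameEdge a b u v)
    ; sym = λ u v → symProof u v
    ; irrefl = λ v → irr v }
    where
      open import Data.Bool.Properties using (∨-comm)
      symSame : ∀ u v → sameEdge a b u v ≡ sameEdge a b v u
      symSame u v with u ≟ a | v ≟ b | u ≟ b | v ≟ a
      ... | yes _ | yes _ | yes _ | yes _ = refl
      ... | yes _ | yes _ | yes _ | no  _ = refl
      ... | yes _ | yes _ | no  _ | yes _ = refl
      ... | yes _ | yes _ | no  _ | no  _ = refl
      ... | yes _ | no  _ | yes _ | yes _ = refl
      ... | yes _ | no  _ | yes _ | no  _ = refl
      ... | yes _ | no  _ | no  _ | yes _ = refl
      ... | yes _ | no  _ | no  _ | no  _ = refl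
      ... | no  _ | yes _ | yes _ | yes _ = refl
      ... | no  _ | yes _ | yes _ | no  _ = refl
      ... | no  _ | yes _ | no  _ | yes _ = refl
      ... | no  _ | yes _ | no  _ | no  _ = refl
      ... | no  _ | no  _ | yes _ | yes _ = refl
      ... | no  _ | no  _ | yes _ | no  _ = refl
      ... | no  _ | no  _ | no  _ | yes _ = refl
      ... | no  _ | no  _ | no  _ | no  _ = refl
      symProof : ∀ u v → adj G u v ∧ not (sameEdge a b u v) ≡ adj G v u ∧ not (sameEdge a b v u)
      symProof u v rewrite sym G u v | symSame u v = refl
      irr : ∀ v → adj G v v ∧ not (sameEdge a b v v) ≡ false
      irr v rewrite irrefl G v = refl

data Owner : Set where
  free dom sta : Owner

Position : Set → Set
Position V = V → Owner

module Game {V : Set} (_≟_ : DecidableEquality V) (G : Graph V) where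

  InN : V → V → Set
  InN v u = (u ≡ v) ⊎ (adj G u v ≡ true)

  Dominated : Position V → Set
  Dominated p = ∀ v → ∃ λ u → p u ≡ dom × InN v u

  play : Position V → V → Owner → Position V
  play p v o u with u ≟ v
  ... | yes _ = o
  ... | no  _ = p u

  -- DWins m p : in position p with Dominator to move, Dominator has a
  -- strategy guaranteeing that he wins (his selected vertices become a
  -- dominating set) having made at most m further moves, whatever
  -- Staller does.
  data DWins : ℕ → Position V → Set where
    won  : ∀ {m p} → Dominated p → DWins m p
    move : ∀ {m p} (v : V) → p v ≡ free →
           (Dominated (play p v dom)
            ⊎ ((∃ λ u → play p v dom u ≡ free)
               × (∀ u → play p v dom u ≡ free →
                        DWins m (play (play p v dom) u sta)))) →
           DWins (suc m) p

  start : Position V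
  start _ = free

DWinsD : {V : Set} → DecidableEquality V → Graph V → ℕ → Set
DWinsD _≟_ G m = Game.DWins _≟_ G m (Game.start _≟_ G)

γMB≡ : {V : Set} → DecidableEquality V → Graph V → ℕ → Set
γMB≡ _≟_ G k = DWinsD _≟_ G k × (∀ m → DWinsD _≟_ G m → k ≤ m)

-- k < γ_MB(G)  (including the case γ_MB(G) = ∞)
γMB> : {V : Set} → DecidableEquality V → Graph V → ℕ → Set
γMB> _≟_ G k = ∀ m → DWinsD _≟_ G m → k < m

data Vtx (k : ℕ) : Set where
  w w' : Vtx k
  x x' y y' : Fin k → Vtx k

module _ {k : ℕ} where
  private
    inj-x : ∀ {i j : Fin k} → x {k} i ≡ x j → i ≡ j
    inj-x refl = refl
    inj-x' : ∀ {i j : Fin k} → x' {k} i ≡ x' j → i ≡ j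
    inj-x' refl = refl
    inj-y : ∀ {i j : Fin k} → y {k} i ≡ y j → i ≡ j
    inj-y refl = refl
    inj-y' : ∀ {i j : Fin k} → y' {k} i ≡ y' j → i ≡ j
    inj-y' refl = refl

  _≟V_ : DecidableEquality (Vtx k)
  w ≟V w = yes refl
  w ≟V w' = no (λ ())
  w ≟V (x j) = no (λ ())
  w ≟V (x' j) = no (λ ())
  w ≟V (y j) = no (λ ())
  w ≟V (y' j) = no (λ ())
  w' ≟V w = no (λ ())
  w' ≟V w' = yes refl
  w' ≟V (x j) = no (λ ())
  w' ≟V (x' j) = no (λ ())
  w' ≟V (y j) = no (λ ())
  w' ≟V (y' j) = no (λ ())
  (x i) ≟V w = no (λ ())
  (x i) ≟V w' = no (λ ())
  (x i) ≟V (x j) = map′ (cong x) (inj-x) (i Fin.≟ j)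
  (x i) ≟V (x' j) = no (λ ())
  (x i) ≟V (y j) = no (λ ())
  (x i) ≟V (y' j) = no (λ ())
  (x' i) ≟V w = no (λ ())
  (x' i) ≟V w' = no (λ ())
  (x' i) ≟V (x j) = no (λ ())
  (x' i) ≟V (x' j) = map′ (cong x') (inj-x') (i Fin.≟ j)
  (x' i) ≟V (y j) = no (λ ())
  (x' i) ≟V (y' j) = no (λ ())
  (y i) ≟V w = no (λ ())
  (y i) ≟V w' = no (λ ())
  (y i) ≟V (x j) = no (λ ())
  (y i) ≟V (x' j) = no (λ ())
  (y i) ≟V (y j) = map′ (cong y) (inj-y) (i Fin.≟ j)
  (y i) ≟V (y' j) = no (λ ())
  (y' i) ≟V w = no (λ ())
  (y' i) ≟V w' = no (λ ())
  (y' i) ≟V (x j) = no (λ ())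
  (y' i) ≟V (x' j) = no (λ ())
  (y' i) ≟V (y j) = no (λ ())
  (y' i) ≟V (y' j) = map′ (cong y') (inj-y') (i Fin.≟ j)
  eqb : Fin k → Fin k → Bool
  eqb i j = ⌊ i Fin.≟ j ⌋

  edge : Vtx k → Vtx k → Bool
  edge w w' = true
  edge w (x i) = true
  edge w (x' i) = true
  edge (x i) (y j) = eqb i j
  edge (x i) (y' j) = eqb i j
  edge (x' i) (y j) = eqb i j
  edge (x' i) (y' j) = eqb i j
  edge _ _ = false

  adjG : Vtx k → Vtx k → Bool
  adjG u v = edge u v ∨ edge v u

  irrG : ∀ v → adjG v v ≡ false
  irrG w = refl
  irrG w' = refl
  irrG (x i) = refl
  irrG (x' i) = refl
  irrG (y i) = refl
  irrG (y' i) = refl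

Gk : (k : ℕ) → Graph (Vtx k)
Gk k = record { adj = adjG ; sym = λ u v → ∨-comm (edge u v) (edge v u) ; irrefl = irrG }

-- Upper bound: Dominator first claims w, which dominates w, w' and every x i and x' i.  The pairs
-- {x i, x' i} then carry a pairing strategy (when Staller takes a vertex of an untouched pair,
-- Dominator takes the other one), and either vertex of a pair dominates y i and y' i, so k further
-- moves suffice.
--
-- Lower bounds: every dominating set of a spanning subgraph of G_k meets the hub {w, w'} and each
-- block {x i, x' i, y i, y' i}.  Give each of these parts a demand; the deficit, the total demand
-- not yet met by Dominator's vertices, drops by at most one per Dominator move and is unchanged by
-- Staller's moves, so Dominator needs at least that many moves.  In G_k it starts at k + 1.  In
-- G_k - e Staller answers every opening except w by taking w, and the opening w by a vertex chosen
-- according to e.  A block meets a dominating set in a single vertex only if that vertex is x i or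
-- x' i, w is in the set, and the edges from w to the other of x i, x' i and from the vertex to y i
-- and y' i are all present; after Staller's answer this fails for the block of e, which therefore
-- demands two vertices, and the deficit starts at k + 2.  For e = ww', Staller answers every opening except w' by taking w',
-- which can then never be dominated.
module Submission where

open import Defs hiding (sym)
open import Data.Nat using (ℕ; zero; suc; _+_; _∸_; _≤_; _<_; z≤n; s≤s)
open import Data.Nat.Properties
  using (+-0-commutativeMonoid; m≤n+m; +-mono-≤; +-monoˡ-≤; +-monoʳ-≤; +-mono-<-≤; +-mono-≤-<; +-suc;
         ≤-refl; ≤-reflexive; ≤-trans; ≤-pred; n≤1+n; n<1+n; m≤n+m∸n; m≤n+o⇒m∸n≤o; ∸-monoʳ-≤;
         ∸-monoʳ-<; m≤n⇒m∸n≡0; module ≤-Reasoning)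
open import Data.Bool using (true; false; _∨_; _∧_; not)
open import Data.Bool.Properties using (T-≡; ∧-zeroʳ)
open import Data.Fin as Fin using (Fin; zero; suc; fromℕ<)
open import Data.Fin.Properties using (suc-injective; any?; all?; ¬∀⟶∃¬)
open import Data.List using (List; []; _∷_)
open import Data.List.Relation.Unary.Any using (Any; here; there)
open import Data.List.Relation.Unary.All using (_∷_; [])
open import Data.List.Relation.Unary.All.Properties using (All¬⇒¬Any)
open import Data.List.Relation.Unary.Unique.Propositional using (Unique; _∷_; [])
open import Data.Product using (∃; _×_; _,_; proj₁)
open import Data.Sum using (_⊎_; inj₁; inj₂; [_,_]′)
open import Data.Unit using (⊤; tt)
open import Data.Empty using (⊥)
open import Function using (_∘_; flip; Equivalence)
open import Relation.Nullary using (¬_; Dec; yes; no)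
open import Relation.Nullary.Decidable using (_⊎-dec_; _×-dec_; toWitness; fromWitness)
open import Relation.Nullary.Negation using (contradiction)
open import Relation.Binary.Definitions using (DecidableEquality)
open import Relation.Binary.PropositionalEquality using (_≡_; _≢_; refl; sym; trans; cong; cong₂; subst)
open import Algebra.Properties.CommutativeMonoid.Sum +-0-commutativeMonoid
  using (sum; sum-cong-≗; sum-replicate-zero)
import Data.List.Membership.DecPropositional as DecMembership

sum-mono-≤ : ∀ {n} {f g : Fin n → ℕ} → (∀ i → f i ≤ g i) → sum f ≤ sum g
sum-mono-≤ {zero} _ = z≤n
sum-mono-≤ {suc n} f≤g = +-mono-≤ (f≤g zero) (sum-mono-≤ (f≤g ∘ suc))

sum-mono-<-at : ∀ {n} {f g : Fin n → ℕ} (j : Fin n) → (∀ i → f i ≤ g i) → f j < g j → sum f < sum g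
sum-mono-<-at zero f≤g fj<gj = +-mono-<-≤ fj<gj (sum-mono-≤ (f≤g ∘ suc))
sum-mono-<-at (suc j) f≤g fj<gj = +-mono-≤-< (f≤g zero) (sum-mono-<-at j (f≤g ∘ suc) fj<gj)

sum-≤-suc-at : ∀ {n} {f g : Fin n → ℕ} (j : Fin n) →
               (∀ i → i ≢ j → f i ≤ g i) → f j ≤ suc (g j) → sum f ≤ suc (sum g)
sum-≤-suc-at zero f≤g fj≤ = +-mono-≤ fj≤ (sum-mono-≤ (λ i → f≤g (suc i) (λ ())))
sum-≤-suc-at {g = g} (suc j) f≤g fj≤ =
  ≤-trans (+-mono-≤ (f≤g zero (λ ())) (sum-≤-suc-at j (λ i i≢j → f≤g (suc i) (i≢j ∘ suc-injective)) fj≤))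
          (≤-reflexive (+-suc (g zero) _))

ones : ∀ {n} → Fin n → ℕ
ones _ = 1

sum-ones : ∀ n → sum (ones {n}) ≡ n
sum-ones zero = refl
sum-ones (suc n) = cong suc (sum-ones n)

∸-suc-≤ : ∀ d {c c′} → c′ ≤ suc c → d ∸ c ≤ suc (d ∸ c′)
∸-suc-≤ d {c} {c′} c′≤ = m≤n+o⇒m∸n≤o d c (begin
  d                 ≤⟨ m≤n+m∸n d c′ ⟩
  c′ + (d ∸ c′)     ≤⟨ +-monoˡ-≤ (d ∸ c′) c′≤ ⟩
  suc c + (d ∸ c′)  ≡⟨ sym (+-suc c (d ∸ c′)) ⟩
  c + suc (d ∸ c′)  ∎)
  where open ≤-Reasoning

∸-< : ∀ d {c c′} → c < d → c < c′ → d ∸ c′ < d ∸ c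
∸-< d {c} c<d c<c′ = ≤-trans (s≤s (∸-monoʳ-≤ d c<c′)) (∸-monoʳ-< (n<1+n c) c<d)

_≟ₒ_ : DecidableEquality Owner
free ≟ₒ free = yes refl
free ≟ₒ dom  = no (λ ())
free ≟ₒ sta  = no (λ ())
dom  ≟ₒ free = no (λ ())
dom  ≟ₒ dom  = yes refl
dom  ≟ₒ sta  = no (λ ())
sta  ≟ₒ free = no (λ ())
sta  ≟ₒ dom  = no (λ ())
sta  ≟ₒ sta  = yes refl

dom# : Owner → ℕ
dom# dom  = 1
dom# free = 0
dom# sta  = 0

domCount : {V : Set} → Position V → List V → ℕ
domCount p [] = 0
domCount p (u ∷ us) = dom# (p u) + domCount p us

module _ {V : Set} (p : Position V) where
  open import Data.List.Membership.Propositional using (_∈_)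

  one-dominator : ∀ {u us} → u ∈ us → p u ≡ dom → 1 ≤ domCount p us
  one-dominator (here refl) pu rewrite pu = s≤s z≤n
  one-dominator {us = u′ ∷ _} (there u∈) pu = ≤-trans (one-dominator u∈ pu) (m≤n+m _ (dom# (p u′)))

  two-dominators : ∀ {u u′ us} → u ∈ us → u′ ∈ us → u ≢ u′ → p u ≡ dom → p u′ ≡ dom →
                   2 ≤ domCount p us
  two-dominators (here refl) (here refl) u≢u′ _ _ = contradiction refl u≢u′
  two-dominators (here refl) (there u′∈) _ pu pu′ rewrite pu = s≤s (one-dominator u′∈ pu′)
  two-dominators (there u∈) (here refl) _ pu pu′ rewrite pu′ = s≤s (one-dominator u∈ pu)
  two-dominators {us = u″ ∷ _} (there u∈) (there u′∈) u≢u′ pu pu′ =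
    ≤-trans (two-dominators u∈ u′∈ u≢u′ pu pu′) (m≤n+m _ (dom# (p u″)))

module _ {V : Set} {p q : Position V} where
  open import Data.List.Membership.Propositional using (_∈_)

  domCount-cong : ∀ us → (∀ {u} → u ∈ us → dom# (p u) ≡ dom# (q u)) → domCount p us ≡ domCount q us
  domCount-cong [] _ = refl
  domCount-cong (u ∷ us) same = cong₂ _+_ (same (here refl)) (domCount-cong us (same ∘ there))

  domCount-mono : ∀ us → (∀ u → dom# (p u) ≤ dom# (q u)) → domCount p us ≤ domCount q us
  domCount-mono [] _ = z≤n
  domCount-mono (u ∷ us) ≤q = +-mono-≤ (≤q u) (domCount-mono us ≤q)

_⊆_ : {V : Set} → Graph V → Graph V → Set
H ⊆ G = ∀ u v → adj H u v ≡ true → adj G u v ≡ true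

⊆-refl : {V : Set} {G : Graph V} → G ⊆ G
⊆-refl _ _ e = e

module _ {V : Set} (_≟_ : DecidableEquality V) (G : Graph V) {a b : V} where

  removeEdge-⊆ : removeEdge _≟_ G a b ⊆ G
  removeEdge-⊆ u v e with adj G u v
  ... | true = refl

  removeEdge-deletes : adj (removeEdge _≟_ G a b) a b ≡ false
  removeEdge-deletes = trans (cong (λ s → adj G a b ∧ not s) same) (∧-zeroʳ (adj G a b))
    where
    same : sameEdge _≟_ a b a b ≡ true
    same with a ≟ a | b ≟ b
    ... | yes _ | yes _ = refl
    ... | no a≢a | _ = contradiction refl a≢a
    ... | yes _ | no b≢b = contradiction refl b≢b

module GameFacts {V : Set} (_≟_ : DecidableEquality V) (G : Graph V) where
  open Game _≟_ G
  open DecMembership _≟_ using (_∈_; _∉_; lose)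

  play-≡ : ∀ p v o → play p v o v ≡ o
  play-≡ p v o with v ≟ v
  ... | yes _ = refl
  ... | no v≢v = contradiction refl v≢v

  play-≢ : ∀ {p v u} o → u ≢ v → play p v o u ≡ p u
  play-≢ {v = v} {u = u} o u≢v with u ≟ v
  ... | yes u≡v = contradiction u≡v u≢v
  ... | no _ = refl

  Stable : (Position V → Set) → Set
  Stable P = ∀ p {v o} → P p → p v ≡ free → P (play p v o)

  owner-stable : ∀ {u o} → o ≢ free → Stable (λ p → p u ≡ o)
  owner-stable {u} o≢free _ {v} pu fv with u ≟ v
  ... | yes refl = contradiction (trans (sym pu) fv) o≢free
  ... | no _ = pu

  dom#-sta : ∀ {p v} u → p v ≡ free → dom# (play p v sta u) ≡ dom# (p u)
  dom#-sta {v = v} u fv with u ≟ v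
  ... | yes refl rewrite fv = refl
  ... | no _ = refl

  dom#-dom : ∀ {p v} u → p v ≡ free → dom# (p u) ≤ dom# (play p v dom u)
  dom#-dom {v = v} u fv with u ≟ v
  ... | yes refl rewrite fv = z≤n
  ... | no _ = ≤-refl

  domCount-sta : ∀ {p v} us → p v ≡ free → domCount (play p v sta) us ≡ domCount p us
  domCount-sta us fv = domCount-cong us (λ {u} _ → dom#-sta u fv)

  domCount-∉ : ∀ {p v} o us → v ∉ us → domCount (play p v o) us ≡ domCount p us
  domCount-∉ o us v∉ = domCount-cong us (λ u∈ → cong dom# (play-≢ o (λ { refl → v∉ u∈ })))

  domCount-dom-mono : ∀ {p v} us → p v ≡ free → domCount p us ≤ domCount (play p v dom) us
  domCount-dom-mono us fv = domCount-mono us (λ u → dom#-dom u fv)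

  domCount-dom-∈ : ∀ {p v us} → p v ≡ free → v ∈ us → domCount p us < domCount (play p v dom) us
  domCount-dom-∈ {p} {v} {_ ∷ us} fv (here refl) = +-mono-<-≤ claimed (domCount-dom-mono us fv)
    where
    claimed : dom# (p v) < dom# (play p v dom v)
    claimed rewrite fv | play-≡ p v dom = s≤s z≤n
  domCount-dom-∈ {us = u ∷ _} fv (there v∈) = +-mono-≤-< (dom#-dom u fv) (domCount-dom-∈ fv v∈)

  domCount-dom-unique : ∀ {p v us} → p v ≡ free → Unique us →
                        domCount (play p v dom) us ≤ suc (domCount p us)
  domCount-dom-unique {us = []} _ _ = z≤n
  domCount-dom-unique {p} {v} {u ∷ us} fv (u∉ ∷ unique) with u ≟ v
  ... | yes refl rewrite fv = s≤s (≤-reflexive (domCount-∉ dom us (All¬⇒¬Any u∉)))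
  ... | no _ = ≤-trans (+-monoʳ-≤ (dom# (p u)) (domCount-dom-unique fv unique)) (≤-reflexive (+-suc _ _))

  dominator-in : ∀ {p z L} → Dominated p → (∀ {u} → InN z u → u ∈ L) →
                 Any (λ u → p u ≡ dom × InN z u) L
  dominator-in {z = z} dominated nbhd with dominated z
  ... | u , pu , u∈N = lose (nbhd u∈N) (pu , u∈N)

  StallerOwnsN[_] : V → Position V → Set
  StallerOwnsN[ z ] p = ∀ {u} → InN z u → p u ≡ sta

  stallerOwnsN-stable : ∀ {z} → Stable StallerOwnsN[ z ]
  stallerOwnsN-stable _ owned fv u∈N = owner-stable (λ ()) _ (owned u∈N) fv

  stallerOwnsN⇒¬DWins : ∀ {z m p} → StallerOwnsN[ z ] p → ¬ DWins m p
  stallerOwnsN⇒¬DWins {z} owned (won dominated) with dominated z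
  ... | u , pu , u∈N = contradiction (trans (sym pu) (owned u∈N)) (λ ())
  stallerOwnsN⇒¬DWins {z} owned (move v fv (inj₁ dominated)) with dominated z
  ... | u , pu , u∈N = contradiction (trans (sym pu) (stallerOwnsN-stable _ owned fv u∈N)) (λ ())
  stallerOwnsN⇒¬DWins owned (move v fv (inj₂ ((u , fu) , next))) =
    stallerOwnsN⇒¬DWins (stallerOwnsN-stable _ (stallerOwnsN-stable _ owned fv) fu) (next u fu)

  AfterMove : ℕ → Position V → Set
  AfterMove m p = Dominated p ⊎ ((∃ λ u → p u ≡ free) × (∀ u → p u ≡ free → DWins m (play p u sta)))

  bound-by-replies : ∀ {n p} → ¬ DWins 1 p →
    (∀ {v} → p v ≡ free →
       ∃ λ s → play p v dom s ≡ free × (∀ {m} → DWins m (play (play p v dom) s sta) → n ≤ m)) →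
    ∀ {m} → DWins m p → suc n ≤ m
  bound-by-replies no-quick-win _ (won dominated) = contradiction (won dominated) no-quick-win
  bound-by-replies no-quick-win _ (move v fv (inj₁ dominated)) =
    contradiction (move v fv (inj₁ dominated)) no-quick-win
  bound-by-replies _ reply (move v fv (inj₂ (_ , next))) with reply fv
  ... | s , fs , bound = s≤s (bound (next s fs))

module Deficit {V : Set} (_≟_ : DecidableEquality V) (G : Graph V)
               {n : ℕ} (parts : Fin n → List V) (demand : Fin n → ℕ) where
  open Game _≟_ G
  open GameFacts _≟_ G
  open DecMembership _≟_ using (_∈_; _∉_; _∈?_)

  deficit : Position V → ℕ
  deficit p = sum (λ i → demand i ∸ domCount p (parts i))

  Meets : Position V → Set
  Meets p = ∀ i → demand i ≤ domCount p (parts i)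

  deficit-sta : ∀ {p v} → p v ≡ free → deficit (play p v sta) ≡ deficit p
  deficit-sta fv = sum-cong-≗ (λ i → cong (demand i ∸_) (domCount-sta (parts i) fv))

  deficit-met : ∀ {p m} → Meets p → deficit p ≤ m
  deficit-met meets =
    ≤-trans (≤-reflexive (trans (sum-cong-≗ (λ i → m≤n⇒m∸n≡0 (meets i))) (sum-replicate-zero n))) z≤n

  term-∉ : ∀ {p v o} i → v ∉ parts i →
           demand i ∸ domCount (play p v o) (parts i) ≡ demand i ∸ domCount p (parts i)
  term-∉ {o = o} i v∉ = cong (demand i ∸_) (domCount-∉ o (parts i) v∉)

  deficit-dom-< : ∀ {p v j} → p v ≡ free → v ∈ parts j → domCount p (parts j) < demand j →
                  deficit (play p v dom) < deficit p
  deficit-dom-< {j = j} fv v∈ unmet =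
    sum-mono-<-at j (λ i → ∸-monoʳ-≤ (demand i) (domCount-dom-mono (parts i) fv))
                    (∸-< (demand j) unmet (domCount-dom-∈ fv v∈))

  module _ (unique : ∀ i → Unique (parts i))
           (disjoint : ∀ {v i j} → v ∈ parts i → v ∈ parts j → i ≡ j) where

    deficit-dom-≤ : ∀ {p v} → p v ≡ free → deficit p ≤ suc (deficit (play p v dom))
    deficit-dom-≤ {p} {v} fv with any? (λ i → v ∈? parts i)
    ... | yes (j , v∈j) = sum-≤-suc-at j (λ i i≢j → ≤-reflexive (sym (term-∉ i (i≢j ∘ flip disjoint v∈j))))
                                         (∸-suc-≤ (demand j) (domCount-dom-unique fv (unique j)))
    ... | no v∉ = ≤-trans (≤-reflexive (sum-cong-≗ (λ i → sym (term-∉ i (v∉ ∘ (i ,_)))))) (n≤1+n _)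

    module _ {Inv : Position V → Set} (stable : Stable Inv)
             (meets : ∀ {p} → Inv p → Dominated p → Meets p) where

      deficit-≤-moves : ∀ {m p} → Inv p → DWins m p → deficit p ≤ m
      deficit-≤-moves inv (won dominated) = deficit-met (meets inv dominated)
      deficit-≤-moves inv (move v fv (inj₁ dominated)) =
        ≤-trans (deficit-dom-≤ fv) (s≤s (deficit-met (meets (stable _ inv fv) dominated)))
      deficit-≤-moves inv (move v fv (inj₂ ((u , fu) , next))) =
        ≤-trans (deficit-dom-≤ fv) (s≤s (subst (_≤ _) (deficit-sta fu) (deficit-≤-moves inv′ (next u fu))))
        where inv′ = stable _ (stable _ inv fv) fu

      deficit-≤-after-reply : ∀ {m p v s} → p v ≡ free → play p v dom s ≡ free →
        Inv (play (play p v dom) s sta) → DWins m (play (play p v dom) s sta) → deficit p ≤ suc m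
      deficit-≤-after-reply fv fs inv wins =
        ≤-trans (deficit-dom-≤ fv) (s≤s (subst (_≤ _) (deficit-sta fs) (deficit-≤-moves inv wins)))

module Pairing {V : Set} (_≟_ : DecidableEquality V) (G : Graph V) {n : ℕ} (a b : Fin n → V)
               (a-injective : ∀ {i j} → a i ≡ a j → i ≡ j) (b-injective : ∀ {i j} → b i ≡ b j → i ≡ j)
               (a≢b : ∀ i j → a i ≢ b j) where
  open Game _≟_ G
  open GameFacts _≟_ G
  open DecMembership _≟_ using (_∈_; _∉_; _∈?_)

  pair : Fin n → List V
  pair i = a i ∷ b i ∷ []

  open Deficit _≟_ G pair ones using (deficit; deficit-sta; deficit-dom-<)

  pairs-disjoint : ∀ {v i j} → v ∈ pair i → v ∈ pair j → i ≡ j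
  pairs-disjoint (here refl) (here ai≡aj) = a-injective ai≡aj
  pairs-disjoint (here refl) (there (here ai≡bj)) = contradiction ai≡bj (a≢b _ _)
  pairs-disjoint (there (here refl)) (here bi≡aj) = contradiction (sym bi≡aj) (a≢b _ _)
  pairs-disjoint (there (here refl)) (there (here bi≡bj)) = b-injective bi≡bj

  Claimed : Fin n → Position V → Set
  Claimed i p = p (a i) ≡ dom ⊎ p (b i) ≡ dom

  Untouched : Fin n → Position V → Set
  Untouched i p = p (a i) ≡ free × p (b i) ≡ free

  Paired : Position V → Set
  Paired p = ∀ i → Claimed i p ⊎ Untouched i p

  claimed? : ∀ i p → Dec (Claimed i p)
  claimed? i p = (p (a i) ≟ₒ dom) ⊎-dec (p (b i) ≟ₒ dom)

  untouched? : ∀ i p → Dec (Untouched i p)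
  untouched? i p = (p (a i) ≟ₒ free) ×-dec (p (b i) ≟ₒ free)

  claimed-stable : ∀ {i} → Stable (Claimed i)
  claimed-stable _ (inj₁ pa) fv = inj₁ (owner-stable (λ ()) _ pa fv)
  claimed-stable _ (inj₂ pb) fv = inj₂ (owner-stable (λ ()) _ pb fv)

  untouched-stable : ∀ {i p v o} → v ∉ pair i → Untouched i p → Untouched i (play p v o)
  untouched-stable v∉ (fa , fb) =
    trans (play-≢ _ (v∉ ∘ here ∘ sym)) fa , trans (play-≢ _ (v∉ ∘ there ∘ here ∘ sym)) fb

  claim : ∀ {i p v} → v ∈ pair i → Claimed i (play p v dom)
  claim {p = p} (here refl) = inj₁ (play-≡ p _ dom)
  claim {p = p} (there (here refl)) = inj₂ (play-≡ p _ dom)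

  untouched-unmet : ∀ {i p} → Untouched i p → domCount p (pair i) < 1
  untouched-unmet (fa , fb) rewrite fa | fb = s≤s z≤n

  record Reply (p : Position V) (u : V) : Set where
    field
      vertex    : V
      index     : Fin n
      is-free   : play p u sta vertex ≡ free
      in-pair   : vertex ∈ pair index
      untouched : Untouched index p
      answers   : ∀ {i} → Untouched i p → u ∈ pair i → vertex ∈ pair i

  reply : ∀ {p u j} → Untouched j p → p u ≡ free → Reply p u
  reply {p} {u} {j} untouched-j fu with any? (λ i → (u ∈? pair i) ×-dec untouched? i p)
  ... | yes (i , here refl , untouched-i@(_ , fb)) = record
    { vertex = b i ; index = i ; is-free = trans (play-≢ sta (a≢b i i ∘ sym)) fb
    ; in-pair = there (here refl) ; untouched = untouched-i
    ; answers = λ _ u∈ → subst (λ i′ → b i ∈ pair i′) (pairs-disjoint (here refl) u∈) (there (here refl)) }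
  ... | yes (i , there (here refl) , untouched-i@(fa , _)) = record
    { vertex = a i ; index = i ; is-free = trans (play-≢ sta (a≢b i i)) fa
    ; in-pair = here refl ; untouched = untouched-i
    ; answers = λ _ u∈ → subst (λ i′ → a i ∈ pair i′) (pairs-disjoint (there (here refl)) u∈) (here refl) }
  ... | no unpaired = record
    { vertex = a j ; index = j
    ; is-free = trans (play-≢ sta (λ { refl → unpaired (j , here refl , untouched-j) })) (proj₁ untouched-j)
    ; in-pair = here refl ; untouched = untouched-j
    ; answers = λ untouched-i u∈ → contradiction (_ , u∈ , untouched-i) unpaired }

  paired-after-reply : ∀ {p u r} → Paired p → p u ≡ free → play p u sta r ≡ free →
    (∀ {i} → Untouched i p → u ∈ pair i → r ∈ pair i) → Paired (play (play p u sta) r dom)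
  paired-after-reply {r = r} paired fu fr answers i with r ∈? pair i | paired i
  ... | yes r∈ | _ = inj₁ (claim r∈)
  ... | no _ | inj₁ claimed = inj₁ (claimed-stable _ (claimed-stable _ claimed fu) fr)
  ... | no r∉ | inj₂ untouched =
    inj₂ (untouched-stable r∉ (untouched-stable (r∉ ∘ answers untouched) untouched))

  module _ {Base : Position V → Set} (base-stable : Stable Base)
           (covers : ∀ {p} → Base p → (∀ i → Claimed i p) → Dominated p) where

    pairing-strategy : ∀ m {p} → Base p → Paired p → deficit p ≤ m → AfterMove m p
    respond : ∀ m {p r} → Base p → p r ≡ free → Paired (play p r dom) → deficit (play p r dom) < m →
              DWins m p

    pairing-strategy m {p} base paired bound with all? (λ i → claimed? i p)
    ... | yes all-claimed = inj₁ (covers base all-claimed)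
    ... | no some-unclaimed with ¬∀⟶∃¬ n _ (λ i → claimed? i p) some-unclaimed
    ...   | j , unclaimed = inj₂ ((a j , proj₁ untouched-j) , staller-moves)
      where
      untouched-j : Untouched j p
      untouched-j with paired j
      ... | inj₁ claimed = contradiction claimed unclaimed
      ... | inj₂ untouched = untouched

      staller-moves : ∀ u → p u ≡ free → DWins m (play p u sta)
      staller-moves u fu = respond m (base-stable _ base fu) R.is-free
                                   (paired-after-reply paired fu R.is-free R.answers) progress
        where
        module R = Reply (reply {p} {u} {j} untouched-j fu)
        unmet : domCount (play p u sta) (pair R.index) < 1
        unmet = subst (_< 1) (sym (domCount-sta (pair R.index) fu))
                      (untouched-unmet {R.index} {p} R.untouched)
        progress : deficit (play (play p u sta) R.vertex dom) < m
        progress = ≤-trans (deficit-dom-< R.is-free R.in-pair unmet)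
                           (≤-trans (≤-reflexive (deficit-sta fu)) bound)

    respond (suc m) base fr paired (s≤s bound) =
      move _ fr (pairing-strategy m (base-stable _ base fr) paired bound)

data GkEdge {k : ℕ} : Vtx k → Vtx k → Set where
  w-w'  : GkEdge w w'
  w-x   : ∀ j → GkEdge w (x j)
  w-x'  : ∀ j → GkEdge w (x' j)
  x-y   : ∀ j → GkEdge (x j) (y j)
  x-y'  : ∀ j → GkEdge (x j) (y' j)
  x'-y  : ∀ j → GkEdge (x' j) (y j)
  x'-y' : ∀ j → GkEdge (x' j) (y' j)

module _ {k : ℕ} where

  eqb⇒≡ : ∀ {i j : Fin k} → eqb i j ≡ true → i ≡ j
  eqb⇒≡ e = toWitness (Equivalence.from T-≡ e)

  eqb-refl : ∀ (i : Fin k) → eqb i i ≡ true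
  eqb-refl i = Equivalence.to T-≡ (fromWitness refl)

  edge⇒GkEdge : ∀ (a b : Vtx k) → edge a b ≡ true → GkEdge a b
  edge⇒GkEdge w w' _ = w-w'
  edge⇒GkEdge w (x j) _ = w-x j
  edge⇒GkEdge w (x' j) _ = w-x' j
  edge⇒GkEdge (x i) (y j) e rewrite eqb⇒≡ e = x-y j
  edge⇒GkEdge (x i) (y' j) e rewrite eqb⇒≡ e = x-y' j
  edge⇒GkEdge (x' i) (y j) e rewrite eqb⇒≡ e = x'-y j
  edge⇒GkEdge (x' i) (y' j) e rewrite eqb⇒≡ e = x'-y' j

  edge-view : ∀ {a b : Vtx k} → adj (Gk k) a b ≡ true → GkEdge a b ⊎ GkEdge b a
  edge-view {a} {b} e with edge a b in ab
  ... | true = inj₁ (edge⇒GkEdge a b ab)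
  ... | false = inj₂ (edge⇒GkEdge b a e)

  GkEdge⇒adj : ∀ {a b : Vtx k} → GkEdge a b → adj (Gk k) a b ≡ true
  GkEdge⇒adj w-w' = refl
  GkEdge⇒adj (w-x j) = refl
  GkEdge⇒adj (w-x' j) = refl
  GkEdge⇒adj (x-y j) = cong (_∨ false) (eqb-refl j)
  GkEdge⇒adj (x-y' j) = cong (_∨ false) (eqb-refl j)
  GkEdge⇒adj (x'-y j) = cong (_∨ false) (eqb-refl j)
  GkEdge⇒adj (x'-y' j) = cong (_∨ false) (eqb-refl j)

  open Game _≟V_ (Gk k) using (InN)
  open import Data.List.Membership.Propositional using (_∈_)

  N[w'] : ∀ {u} → InN w' u → u ∈ w' ∷ w ∷ []
  N[w'] (inj₁ refl) = here refl
  N[w'] {u} (inj₂ e) with edge-view {a = u} e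
  ... | inj₁ w-w' = there (here refl)

  N[x] : ∀ {j u} → InN (x j) u → u ∈ x j ∷ w ∷ y j ∷ y' j ∷ []
  N[x] (inj₁ refl) = here refl
  N[x] {j} {u} (inj₂ e) with edge-view {a = u} {x j} e
  ... | inj₁ (w-x _) = there (here refl)
  ... | inj₂ (x-y _) = there (there (here refl))
  ... | inj₂ (x-y' _) = there (there (there (here refl)))

  N[x'] : ∀ {j u} → InN (x' j) u → u ∈ x' j ∷ w ∷ y j ∷ y' j ∷ []
  N[x'] (inj₁ refl) = here refl
  N[x'] {j} {u} (inj₂ e) with edge-view {a = u} {x' j} e
  ... | inj₁ (w-x' _) = there (here refl)
  ... | inj₂ (x'-y _) = there (there (here refl))
  ... | inj₂ (x'-y' _) = there (there (there (here refl)))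

  N[y] : ∀ {j u} → InN (y j) u → u ∈ y j ∷ x j ∷ x' j ∷ []
  N[y] (inj₁ refl) = here refl
  N[y] {j} {u} (inj₂ e) with edge-view {a = u} {y j} e
  ... | inj₁ (x-y _) = there (here refl)
  ... | inj₁ (x'-y _) = there (there (here refl))

  N[y'] : ∀ {j u} → InN (y' j) u → u ∈ y' j ∷ x j ∷ x' j ∷ []
  N[y'] (inj₁ refl) = here refl
  N[y'] {j} {u} (inj₂ e) with edge-view {a = u} {y' j} e
  ... | inj₁ (x-y' _) = there (here refl)
  ... | inj₁ (x'-y' _) = there (there (here refl))

  hub : List (Vtx k)
  hub = w ∷ w' ∷ []

  block : Fin k → List (Vtx k)
  block j = x j ∷ x' j ∷ y j ∷ y' j ∷ []

  parts : Fin (suc k) → List (Vtx k)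
  parts zero = hub
  parts (suc j) = block j

  part : Vtx k → Fin (suc k)
  part w = zero
  part w' = zero
  part (x j) = suc j
  part (x' j) = suc j
  part (y j) = suc j
  part (y' j) = suc j

  ∈parts⇒part : ∀ {v i} → v ∈ parts i → part v ≡ i
  ∈parts⇒part {i = zero} (here refl) = refl
  ∈parts⇒part {i = zero} (there (here refl)) = refl
  ∈parts⇒part {i = suc j} (here refl) = refl
  ∈parts⇒part {i = suc j} (there (here refl)) = refl
  ∈parts⇒part {i = suc j} (there (there (here refl))) = refl
  ∈parts⇒part {i = suc j} (there (there (there (here refl)))) = refl

  parts-disjoint : ∀ {v i j} → v ∈ parts i → v ∈ parts j → i ≡ j
  parts-disjoint v∈i v∈j = trans (sym (∈parts⇒part v∈i)) (∈parts⇒part v∈j)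

  parts-unique : ∀ i → Unique (parts i)
  parts-unique zero = ((λ ()) ∷ []) ∷ [] ∷ []
  parts-unique (suc j) =
    ((λ ()) ∷ (λ ()) ∷ (λ ()) ∷ []) ∷ ((λ ()) ∷ (λ ()) ∷ []) ∷ ((λ ()) ∷ []) ∷ [] ∷ []

  x-injective : ∀ {i j : Fin k} → x i ≡ x j → i ≡ j
  x-injective refl = refl

  x'-injective : ∀ {i j : Fin k} → x' i ≡ x' j → i ≡ j
  x'-injective refl = refl

  x≢x' : ∀ (i j : Fin k) → x i ≢ x' j
  x≢x' _ _ ()

module UpperBound (k : ℕ) where
  open Game _≟V_ (Gk k)
  open GameFacts _≟V_ (Gk k)
  open Pairing _≟V_ (Gk k) x x' x-injective x'-injective x≢x'

  covers : ∀ {p} → p w ≡ dom → (∀ i → Claimed i p) → Dominated p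
  covers pw _ w = w , pw , inj₁ refl
  covers pw _ w' = w , pw , inj₂ refl
  covers pw _ (x j) = w , pw , inj₂ refl
  covers pw _ (x' j) = w , pw , inj₂ refl
  covers _ claimed (y j) with claimed j
  ... | inj₁ px = x j , px , inj₂ (GkEdge⇒adj (x-y j))
  ... | inj₂ px' = x' j , px' , inj₂ (GkEdge⇒adj (x'-y j))
  covers _ claimed (y' j) with claimed j
  ... | inj₁ px = x j , px , inj₂ (GkEdge⇒adj (x-y' j))
  ... | inj₂ px' = x' j , px' , inj₂ (GkEdge⇒adj (x'-y' j))

  dominator-wins-in-k+1 : DWinsD _≟V_ (Gk k) (suc k)
  dominator-wins-in-k+1 = move w refl
    (pairing-strategy (owner-stable (λ ())) covers k refl (λ _ → inj₂ (refl , refl))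
                      (≤-reflexive (sum-ones k)))

withHub : ∀ {k} → (Fin k → ℕ) → Fin (suc k) → ℕ
withHub d zero = 1
withHub d (suc j) = d j

twoAt : ∀ {k} → Fin k → Fin k → ℕ
twoAt j i with i Fin.≟ j
... | yes _ = 2
... | no _ = 1

module LowerBound {k : ℕ} (H : Graph (Vtx k)) (H⊆Gk : H ⊆ Gk k) where
  open Game _≟V_ H
  open GameFacts _≟V_ H
  open import Data.List.Membership.Propositional using (_∈_)

  InN-Gk : ∀ {z u} → InN z u → Game.InN _≟V_ (Gk k) z u
  InN-Gk (inj₁ u≡z) = inj₁ u≡z
  InN-Gk (inj₂ e) = inj₂ (H⊆Gk _ _ e)

  adjacent : ∀ {z u} → u ≢ z → InN z u → adj H u z ≡ true
  adjacent u≢z (inj₁ u≡z) = contradiction u≡z u≢z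
  adjacent _ (inj₂ e) = e

  x∈block : ∀ {j : Fin k} → x j ∈ block j
  x∈block = here refl

  x'∈block : ∀ {j : Fin k} → x' j ∈ block j
  x'∈block = there (here refl)

  y∈block : ∀ {j : Fin k} → y j ∈ block j
  y∈block = there (there (here refl))

  y'∈block : ∀ {j : Fin k} → y' j ∈ block j
  y'∈block = there (there (there (here refl)))

  -- The only ways a block can be dominated while containing a single vertex of Dominator.
  data SingleDominator (p : Position (Vtx k)) (j : Fin k) : Set where
    via-x  : p (x j) ≡ dom → p w ≡ dom → adj H w (x' j) ≡ true →
             adj H (x j) (y j) ≡ true → adj H (x j) (y' j) ≡ true → SingleDominator p j
    via-x' : p (x' j) ≡ dom → p w ≡ dom → adj H w (x j) ≡ true →
             adj H (x' j) (y j) ≡ true → adj H (x' j) (y' j) ≡ true → SingleDominator p j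

  module _ {p : Position (Vtx k)} (dominated : Dominated p) (j : Fin k) where

    two : ∀ {u u′} → u ∈ block j → u′ ∈ block j → u ≢ u′ → p u ≡ dom → p u′ ≡ dom →
          2 ≤ domCount p (block j)
    two = two-dominators p

    two-or-single : 2 ≤ domCount p (block j) ⊎ SingleDominator p j
    two-or-single with dominator-in dominated (N[y] ∘ InN-Gk) | dominator-in dominated (N[y'] ∘ InN-Gk)
    ... | here (py , _) | here (py' , _) = inj₁ (two y∈block y'∈block (λ ()) py py')
    ... | here (py , _) | there (here (px , _)) = inj₁ (two y∈block x∈block (λ ()) py px)
    ... | here (py , _) | there (there (here (px' , _))) = inj₁ (two y∈block x'∈block (λ ()) py px')
    ... | there (here (px , _)) | here (py' , _) = inj₁ (two x∈block y'∈block (λ ()) px py')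
    ... | there (there (here (px' , _))) | here (py' , _) = inj₁ (two x'∈block y'∈block (λ ()) px' py')
    ... | there (here (px , _)) | there (there (here (px' , _))) = inj₁ (two x∈block x'∈block (λ ()) px px')
    ... | there (there (here (px' , _))) | there (here (px , _)) = inj₁ (two x∈block x'∈block (λ ()) px px')
    ... | there (here (px , xy)) | there (here (_ , xy')) = x-alone px (adjacent (λ ()) xy) (adjacent (λ ()) xy')
      where
      x-alone : p (x j) ≡ dom → adj H (x j) (y j) ≡ true → adj H (x j) (y' j) ≡ true →
                2 ≤ domCount p (block j) ⊎ SingleDominator p j
      x-alone px xy xy' with dominator-in dominated (N[x'] ∘ InN-Gk)
      ... | here (px' , _) = inj₁ (two x∈block x'∈block (λ ()) px px')
      ... | there (here (pw , wx')) = inj₂ (via-x px pw (adjacent (λ ()) wx') xy xy')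
      ... | there (there (here (py , _))) = inj₁ (two x∈block y∈block (λ ()) px py)
      ... | there (there (there (here (py' , _)))) = inj₁ (two x∈block y'∈block (λ ()) px py')
    ... | there (there (here (px' , x'y))) | there (there (here (_ , x'y'))) =
          x'-alone px' (adjacent (λ ()) x'y) (adjacent (λ ()) x'y')
      where
      x'-alone : p (x' j) ≡ dom → adj H (x' j) (y j) ≡ true → adj H (x' j) (y' j) ≡ true →
                 2 ≤ domCount p (block j) ⊎ SingleDominator p j
      x'-alone px' x'y x'y' with dominator-in dominated (N[x] ∘ InN-Gk)
      ... | here (px , _) = inj₁ (two x∈block x'∈block (λ ()) px px')
      ... | there (here (pw , wx)) = inj₂ (via-x' px' pw (adjacent (λ ()) wx) x'y x'y')
      ... | there (there (here (py , _))) = inj₁ (two x'∈block y∈block (λ ()) px' py)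
      ... | there (there (there (here (py' , _)))) = inj₁ (two x'∈block y'∈block (λ ()) px' py')

  block-met : ∀ {p} → Dominated p → ∀ j → 1 ≤ domCount p (block j)
  block-met {p} dominated j with two-or-single dominated j
  ... | inj₁ two = ≤-trans (s≤s z≤n) two
  ... | inj₂ (via-x px _ _ _ _) = one-dominator p x∈block px
  ... | inj₂ (via-x' px' _ _ _ _) = one-dominator p x'∈block px'

  hub-met : ∀ {p} → Dominated p → 1 ≤ domCount p hub
  hub-met {p} dominated with dominator-in dominated (N[w'] ∘ InN-Gk)
  ... | here (pw' , _) = one-dominator p {us = hub} (there (here refl)) pw'
  ... | there (here (pw , _)) = one-dominator p {us = hub} (here refl) pw

  two-in-block : ∀ {s j} → (∀ {p} → p s ≡ sta → ¬ SingleDominator p j) →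
                 ∀ {p} → p s ≡ sta → Dominated p → 2 ≤ domCount p (block j)
  two-in-block not-single ps dominated with two-or-single dominated _
  ... | inj₁ two = two
  ... | inj₂ single = contradiction single (not-single ps)

  at-least-k+1 : ∀ {m} → DWins m start → suc k ≤ m
  at-least-k+1 {m} wins = subst (_≤ m) (cong suc (sum-ones k))
    (deficit-≤-moves parts-unique parts-disjoint {λ _ → ⊤} (λ _ _ _ → tt) meets tt wins)
    where
    open Deficit _≟V_ H parts (withHub ones)
    meets : ∀ {p} → ⊤ → Dominated p → Meets p
    meets _ dominated zero = hub-met dominated
    meets _ dominated (suc j) = block-met dominated j

  reply-forces-k+1 : ∀ {s} j → (∀ {p} → p s ≡ sta → Dominated p → 2 ≤ domCount p (block j)) →
                     ∀ {v m} → s ≢ v → DWins m (play (play start v dom) s sta) → suc k ≤ m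
  reply-forces-k+1 {s} j two {v} {m} s≢v wins = ≤-pred (≤-trans start-deficit
    (deficit-≤-after-reply parts-unique parts-disjoint (owner-stable (λ ())) meets
                           refl (play-≢ dom s≢v) (play-≡ _ s sta) wins))
    where
    open Deficit _≟V_ H parts (withHub (twoAt j))

    meets : ∀ {p} → p s ≡ sta → Dominated p → Meets p
    meets _ dominated zero = hub-met dominated
    meets ps dominated (suc i) with i Fin.≟ j
    ... | yes refl = two ps dominated
    ... | no _ = block-met dominated i

    ones≤twoAt : ∀ i → ones i ≤ twoAt j i
    ones≤twoAt i with i Fin.≟ j
    ... | yes _ = s≤s z≤n
    ... | no _ = s≤s z≤n

    one<twoAt-j : 1 < twoAt j j
    one<twoAt-j with j Fin.≟ j
    ... | yes _ = s≤s (s≤s z≤n)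
    ... | no j≢j = contradiction refl j≢j

    start-deficit : suc (suc k) ≤ deficit start
    start-deficit = s≤s (subst (_< sum (twoAt j)) (sum-ones k) (sum-mono-<-at j ones≤twoAt one<twoAt-j))

  no-quick-win : 1 ≤ k → ¬ DWins 1 start
  no-quick-win 1≤k wins with ≤-trans (s≤s 1≤k) (at-least-k+1 wins)
  ... | s≤s ()

  owned-twice : ∀ {o} → o ≡ sta → o ≡ dom → ⊥
  owned-twice refl ()

  absent : ∀ {a b} → adj H a b ≡ false → adj H a b ≡ true → ⊥
  absent missing present = contradiction (trans (sym present) missing) (λ ())

  w-taken : ∀ {p j} → p w ≡ sta → ¬ SingleDominator p j
  w-taken pw (via-x _ pw′ _ _ _) = owned-twice pw pw′
  w-taken pw (via-x' _ pw′ _ _ _) = owned-twice pw pw′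

  Answer : Vtx k → Set
  Answer v = ∃ λ s → play start v dom s ≡ free × (∀ {m} → DWins m (play (play start v dom) s sta) → suc k ≤ m)

  answer-w-by : 1 ≤ k → ∀ s j → s ≢ w → (∀ {p} → p s ≡ sta → ¬ SingleDominator p j) → γMB> _≟V_ H (suc k)
  answer-w-by 1≤k s j s≢w s-taken _ = bound-by-replies (no-quick-win 1≤k) reply
    where
    reply : ∀ {v} → start v ≡ free → Answer v
    reply {v} _ with v ≟V w
    ... | yes refl = s , play-≢ dom s≢w , reply-forces-k+1 j (two-in-block s-taken) s≢w
    ... | no v≢w = w , play-≢ dom (v≢w ∘ sym) , reply-forces-k+1 j (two-in-block w-taken) (v≢w ∘ sym)

  w'-cut-off : 1 ≤ k → adj H w w' ≡ false → γMB> _≟V_ H (suc k)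
  w'-cut-off 1≤k missing _ = bound-by-replies (no-quick-win 1≤k) reply
    where
    isolated : ∀ {p} → p w' ≡ sta → StallerOwnsN[ w' ] p
    isolated pw' (inj₁ refl) = pw'
    isolated pw' {u} (inj₂ e) with edge-view {a = u} {w'} (H⊆Gk _ _ e)
    ... | inj₁ w-w' = contradiction e (absent missing)

    reply : ∀ {v} → start v ≡ free → Answer v
    reply {v} _ with v ≟V w'
    ... | yes refl = w , refl , reply-forces-k+1 (fromℕ< 1≤k) (two-in-block w-taken) (λ ())
    ... | no v≢w' = w' , play-≢ dom (v≢w' ∘ sym) , λ wins → contradiction wins (stallerOwnsN⇒¬DWins cut-off)
      where
      cut-off : StallerOwnsN[ w' ] (play (play start v dom) w' sta)
      cut-off = isolated {play (play start v dom) w' sta} (play-≡ (play start v dom) w' sta)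

  missing-edge-raises-γMB : 1 ≤ k → ∀ {a b} → GkEdge a b → adj H a b ≡ false → γMB> _≟V_ H (suc k)
  missing-edge-raises-γMB 1≤k w-w' missing = w'-cut-off 1≤k missing
  missing-edge-raises-γMB 1≤k (w-x j) missing = answer-w-by 1≤k (x j) j (λ ()) λ where
    px (via-x px′ _ _ _ _) → owned-twice px px′
    _ (via-x' _ _ wx _ _) → absent missing wx
  missing-edge-raises-γMB 1≤k (w-x' j) missing = answer-w-by 1≤k (x' j) j (λ ()) λ where
    _ (via-x _ _ wx' _ _) → absent missing wx'
    px' (via-x' px′ _ _ _ _) → owned-twice px' px′
  missing-edge-raises-γMB 1≤k (x-y j) missing = answer-w-by 1≤k (x' j) j (λ ()) λ where
    _ (via-x _ _ _ xy _) → absent missing xy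
    px' (via-x' px′ _ _ _ _) → owned-twice px' px′
  missing-edge-raises-γMB 1≤k (x-y' j) missing = answer-w-by 1≤k (x' j) j (λ ()) λ where
    _ (via-x _ _ _ _ xy') → absent missing xy'
    px' (via-x' px′ _ _ _ _) → owned-twice px' px′
  missing-edge-raises-γMB 1≤k (x'-y j) missing = answer-w-by 1≤k (x j) j (λ ()) λ where
    px (via-x px′ _ _ _ _) → owned-twice px px′
    _ (via-x' _ _ _ x'y _) → absent missing x'y
  missing-edge-raises-γMB 1≤k (x'-y' j) missing = answer-w-by 1≤k (x j) j (λ ()) λ where
    px (via-x px′ _ _ _ _) → owned-twice px px′
    _ (via-x' _ _ _ _ x'y') → absent missing x'y'

removeEdge-raises-γMB : ∀ {k} → 1 ≤ k → ∀ {a b : Vtx k} → GkEdge a b ⊎ GkEdge b a →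
                        γMB> _≟V_ (removeEdge _≟V_ (Gk k) a b) (suc k)
removeEdge-raises-γMB {k} 1≤k {a} {b} =
  [ (λ e → missing-edge-raises-γMB 1≤k e deleted)
  , (λ e → missing-edge-raises-γMB 1≤k e (trans (Graph.sym H b a) deleted)) ]′
  where
  H : Graph (Vtx k)
  H = removeEdge _≟V_ (Gk k) a b
  open LowerBound H (removeEdge-⊆ _≟V_ (Gk k))
  deleted : adj H a b ≡ false
  deleted = removeEdge-deletes _≟V_ (Gk k) {a} {b}

proposition3p2 : (k : ℕ) → 1 ≤ k →
    γMB≡ _≟V_ (Gk k) (suc k)
    × (∀ (a b : Vtx k) → adj (Gk k) a b ≡ true →
         γMB> _≟V_ (removeEdge _≟V_ (Gk k) a b) (suc k))
proposition3p2 k 1≤k =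
  (UpperBound.dominator-wins-in-k+1 k , λ _ → LowerBound.at-least-k+1 (Gk k) (⊆-refl {G = Gk k})) ,
  λ a b ab → removeEdge-raises-γMB 1≤k (edge-view {a = a} {b = b} ab)
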